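{- Let $G$ be a nontrivial connected graph. If $G$ has a $\gamma_{tR2}(G)$-function $f=(V_0,V_1,V_2)$ with $V_2=\emptyset$, then $\gamma_{tR2}(G)=\gamma_{\times 2}(G)$.
   Context: All graphs are finite and simple. For $f:V(G)\to\{0,1,2\}$ let $V_i=\{v:f(v)=i\}$ and write $f=(V_0,V_1,V_2)$; $f$ is a total Roman $\{2\}$-dominating function (TR2DF) if every vertex $v$ with $f(v)=0$ has a neighbor $u$ with $f(u)=2$ or two distinct neighbors $x,y$ with $f(x)=f(y)=1$, and the subgraph induced by $V_1\cup V_2$ has no isolated vertices. $\gamma_{tR2}(G)$ is the minimum weight $\sum_v f(v)$ of a TR2DF, and a TR2DF of that weight is a $\gamma_{tR2}(G)$-function. A set $S\subseteq V(G)$ is a double dominating set if $|N[v]\cap S|\ge 2$ for every $v\in V(G)$ (with $N[v]$ the closed neighborhood); $\gamma_{\times2}(G)$ is the minimum size of a double dominating set. -}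

module Defs where

open import Data.Nat using (ℕ; zero; suc; _+_; _≤_; _≥_)
open import Data.Fin using (Fin)
open import Data.Fin.Subset using (Subset; _∈_; _∩_; ∣_∣; inside)
open import Data.Bool using (Bool; true; false; T)
open import Data.Vec using (Vec; tabulate)
open import Data.List using (List; []; _∷_)
open import Data.Product using (Σ; ∃; ∃-syntax; _×_; _,_)
open import Data.Sum using (_⊎_)
open import Relation.Binary.PropositionalEquality using (_≡_; _≢_)
open import Relation.Nullary using (¬_)

record Graph (n : ℕ) : Set where
  field
    adj   : Fin n → Fin n → Bool
    sym   : ∀ u v → adj u v ≡ adj v u
    irrefl : ∀ v → adj v v ≡ false

open Graph public

Adj : ∀ {n} → Graph n → Fin n → Fin n → Set
Adj G u v = T (adj G u v)

data Walk {n : ℕ} (G : Graph n) : Fin n → Fin n → Set where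
  here  : ∀ {u} → Walk G u u
  step  : ∀ {u w v} → Adj G u w → Walk G w v → Walk G u v

Connected : ∀ {n} → Graph n → Set
Connected G = ∀ u v → Walk G u v

sumFin : ∀ {n} → (Fin n → ℕ) → ℕ
sumFin {zero}  f = 0
sumFin {suc n} f = f Fin.zero + sumFin (λ i → f (Fin.suc i))

data Label : Set where
  l0 l1 l2 : Label

val : Label → ℕ
val l0 = 0
val l1 = 1
val l2 = 2

weight : ∀ {n} → (Fin n → Label) → ℕ
weight f = sumFin (λ v → val (f v))

IsTR2DF : ∀ {n} → Graph n → (Fin n → Label) → Set
IsTR2DF G f =
  (∀ v → f v ≡ l0 →
      (∃[ u ] (Adj G v u × f u ≡ l2))
    ⊎ (∃[ x ] ∃[ y ] (x ≢ y × Adj G v x × Adj G v y × f x ≡ l1 × f y ≡ l1)))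
  × (∀ v → f v ≢ l0 → ∃[ u ] (Adj G v u × f u ≢ l0))

IsGammaTR2Function : ∀ {n} → Graph n → (Fin n → Label) → Set
IsGammaTR2Function G f = IsTR2DF G f × (∀ g → IsTR2DF G g → weight f ≤ weight g)

closedNbhd : ∀ {n} → Graph n → Fin n → Subset n
closedNbhd {n} G v = tabulate λ u → eqOrAdj u
  where
  open import Data.Fin using (_≟_)
  open import Data.Bool using (_∨_)
  open import Relation.Nullary.Decidable using (⌊_⌋)
  eqOrAdj : Fin n → Bool
  eqOrAdj u = ⌊ u ≟ v ⌋ ∨ adj G v u

IsDoubleDominating : ∀ {n} → Graph n → Subset n → Set
IsDoubleDominating G S = ∀ v → ∣ closedNbhd G v ∩ S ∣ ≥ 2

IsGammaX2 : ∀ {n} → Graph n → ℕ → Set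
IsGammaX2 G k =
  (∃[ S ] (IsDoubleDominating G S × ∣ S ∣ ≡ k))
  × (∀ S → IsDoubleDominating G S → k ≤ ∣ S ∣)

{-# OPTIONS --safe #-}
-- A labelling f without 2s is the indicator function of its set V₁ of 1-vertices, of weight
-- ∣ V₁ ∣, and it is a TR2DF exactly when V₁ is double dominating: for v ∉ V₁ the two
-- 1-neighbours, for v ∈ V₁ the vertex itself and a 1-neighbour, are two members of N[v] ∩ V₁.
-- So V₁ is a double dominating set of size w(f), and every double dominating set S gives the
-- TR2DF indicator S of weight ∣ S ∣ ≥ w(f).
module Submission where

open import Defs hiding (sym)
open import Data.Nat using (ℕ; _+_; _≥_; suc; _≤_; s≤s)
open import Data.Nat.Properties using (≤-trans; ≤-<-trans; ≤-reflexive; module ≤-Reasoning)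
open import Data.Fin using (Fin; _≟_) renaming (zero to fzero; suc to fsuc)
open import Data.Fin.Subset using (Subset; _∈_; _∉_; _∩_; ∣_∣; Nonempty; inside; outside)
open import Data.Fin.Subset.Properties
  using (nonempty?; Empty-unique; ∣⊥∣≡0; ∣⁅x⁆∣≡1; x∈⁅y⁆⇒x≡y; p⊆q⇒∣p∣≤∣q∣; x∈p∧x≢y⇒x∈p-y; x∈p⇒∣p-x∣<∣p∣; x∈p∩q⁺; x∈p∩q⁻)
open import Data.Bool using (Bool; true; false; T; if_then_else_)
open import Data.Bool.Properties using (T-≡; T-∨)
open import Data.Vec using (_∷_; []; lookup; tabulate; here; there)
open import Data.Vec.Properties using (lookup∘tabulate; []=⇒lookup; lookup⇒[]=)
open import Data.Product using (∃-syntax; ∃₂; _×_; _,_; proj₂)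
open import Data.Sum using (inj₁; inj₂; _⊎_)
open import Function using (Equivalence; _∘_)
open import Relation.Binary.PropositionalEquality using (_≡_; _≢_; _≗_; refl; sym; trans; cong; cong₂; subst; module ≡-Reasoning)
open import Relation.Nullary using (yes; no; contradiction)
open import Relation.Nullary.Decidable using (toWitness; fromWitness)

open Equivalence using (to; from)

private
  variable
    n : ℕ

∣p∣≥1⇒nonempty : (p : Subset n) → 1 ≤ ∣ p ∣ → Nonempty p
∣p∣≥1⇒nonempty {n} p ∣p∣≥1 with nonempty? p
... | yes ne = ne
... | no empty with Empty-unique empty
... | refl = contradiction (≤-trans ∣p∣≥1 (≤-reflexive (∣⊥∣≡0 n))) λ ()

x∈p⇒∣p∣≥1 : ∀ {x} {p : Subset n} → x ∈ p → 1 ≤ ∣ p ∣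
x∈p⇒∣p∣≥1 {x = x} x∈p =
  subst (_≤ _) (∣⁅x⁆∣≡1 x) (p⊆q⇒∣p∣≤∣q∣ λ y∈⁅x⁆ → subst (_∈ _) (sym (x∈⁅y⁆⇒x≡y x y∈⁅x⁆)) x∈p)

distinct-members⇒∣p∣≥2 : ∀ {x y} {p : Subset n} → x ≢ y → x ∈ p → y ∈ p → 2 ≤ ∣ p ∣
distinct-members⇒∣p∣≥2 x≢y x∈p y∈p =
  ≤-<-trans (x∈p⇒∣p∣≥1 (x∈p∧x≢y⇒x∈p-y y∈p (x≢y ∘ sym))) (x∈p⇒∣p-x∣<∣p∣ x∈p)

∣p∣≥2⇒distinct-members : (p : Subset n) → 2 ≤ ∣ p ∣ → ∃₂ λ x y → x ≢ y × x ∈ p × y ∈ p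
∣p∣≥2⇒distinct-members (inside ∷ p) (s≤s ∣p∣≥1) with ∣p∣≥1⇒nonempty p ∣p∣≥1
... | y , y∈p = fzero , fsuc y , (λ ()) , here , there y∈p
∣p∣≥2⇒distinct-members (outside ∷ p) ∣p∣≥2 with ∣p∣≥2⇒distinct-members p ∣p∣≥2
... | x , y , x≢y , x∈p , y∈p = fsuc x , fsuc y , (λ { refl → x≢y refl }) , there x∈p , there y∈p

∈tabulate⁺ : ∀ {g : Fin n → Bool} {x} → T (g x) → x ∈ tabulate g
∈tabulate⁺ {g = g} {x} gx = lookup⇒[]= x _ (trans (lookup∘tabulate g x) (to T-≡ gx))

∈tabulate⁻ : ∀ {g : Fin n → Bool} {x} → x ∈ tabulate g → T (g x)
∈tabulate⁻ {g = g} {x} x∈g = from T-≡ (trans (sym (lookup∘tabulate g x)) ([]=⇒lookup x∈g))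

sumFin-cong : ∀ {f g : Fin n → ℕ} → f ≗ g → sumFin f ≡ sumFin g
sumFin-cong {n = 0}     f≗g = refl
sumFin-cong {n = suc n} f≗g = cong₂ _+_ (f≗g fzero) (sumFin-cong (f≗g ∘ fsuc))

indicator : Subset n → Fin n → Label
indicator S v = if lookup S v then l1 else l0

indicator-∈ : ∀ {S : Subset n} {v} → v ∈ S → indicator S v ≡ l1
indicator-∈ v∈S rewrite []=⇒lookup v∈S = refl

indicator-∉ : ∀ {S : Subset n} {v} → indicator S v ≡ l0 → v ∉ S
indicator-∉ Sv≡l0 v∈S with trans (sym (indicator-∈ v∈S)) Sv≡l0
... | ()

weight-indicator : (S : Subset n) → weight (indicator S) ≡ ∣ S ∣
weight-indicator []          = refl
weight-indicator (true ∷ S)  = cong suc (weight-indicator S)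
weight-indicator (false ∷ S) = weight-indicator S

isOne : Label → Bool
isOne l1 = true
isOne _  = false

V₁ : (Fin n → Label) → Subset n
V₁ f = tabulate (isOne ∘ f)

∈V₁ : ∀ {f : Fin n → Label} {v} → f v ≡ l1 → v ∈ V₁ f
∈V₁ fv≡l1 = ∈tabulate⁺ (subst (T ∘ isOne) (sym fv≡l1) _)

≢l0∧≢l2⇒≡l1 : ∀ {l} → l ≢ l0 → l ≢ l2 → l ≡ l1
≢l0∧≢l2⇒≡l1 {l0} ≢l0 _   = contradiction refl ≢l0
≢l0∧≢l2⇒≡l1 {l1} _   _   = refl
≢l0∧≢l2⇒≡l1 {l2} _   ≢l2 = contradiction refl ≢l2

≗indicator-V₁ : ∀ {f : Fin n → Label} → (∀ v → f v ≢ l2) → f ≗ indicator (V₁ f)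
≗indicator-V₁ {f = f} no-l2 v rewrite lookup∘tabulate (isOne ∘ f) v with f v | no-l2 v
... | l0 | _   = refl
... | l1 | _   = refl
... | l2 | ≢l2 = contradiction refl ≢l2

weight≡∣V₁∣ : ∀ {f : Fin n → Label} → (∀ v → f v ≢ l2) → weight f ≡ ∣ V₁ f ∣
weight≡∣V₁∣ {f = f} no-l2 = begin
  weight f                   ≡⟨ sumFin-cong (cong val ∘ ≗indicator-V₁ no-l2) ⟩
  weight (indicator (V₁ f))  ≡⟨ weight-indicator (V₁ f) ⟩
  ∣ V₁ f ∣                   ∎
  where open ≡-Reasoning

module _ (G : Graph n) where

  Adj⇒≢ : ∀ {u v} → Adj G v u → u ≢ v
  Adj⇒≢ {u} adj refl = subst T (irrefl G u) adj

  ∈closedNbhd⁺ : ∀ {u v} → u ≡ v ⊎ Adj G v u → u ∈ closedNbhd G v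
  ∈closedNbhd⁺ {u} {v} (inj₁ u≡v) = ∈tabulate⁺ (from T-∨ (inj₁ (fromWitness {a? = u ≟ v} u≡v)))
  ∈closedNbhd⁺ (inj₂ adj) = ∈tabulate⁺ (from T-∨ (inj₂ adj))

  ∈closedNbhd⁻ : ∀ {u v} → u ∈ closedNbhd G v → u ≡ v ⊎ Adj G v u
  ∈closedNbhd⁻ u∈N[v] with to T-∨ (∈tabulate⁻ u∈N[v])
  ... | inj₁ u≡v = inj₁ (toWitness u≡v)
  ... | inj₂ adj = inj₂ adj

  ∈closedNbhd∩∧≢⇒Adj : ∀ {S : Subset n} {u v} → u ∈ closedNbhd G v ∩ S → u ≢ v → Adj G v u × u ∈ S
  ∈closedNbhd∩∧≢⇒Adj {S} u∈N∩S u≢v with x∈p∩q⁻ _ S u∈N∩S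
  ... | u∈N , u∈S with ∈closedNbhd⁻ u∈N
  ...   | inj₁ u≡v = contradiction u≡v u≢v
  ...   | inj₂ adj = adj , u∈S

  distinct-members⇒∣closedNbhd∩S∣≥2 : ∀ {S : Subset n} {v x y} → x ≢ y →
    x ≡ v ⊎ Adj G v x → x ∈ S → y ≡ v ⊎ Adj G v y → y ∈ S → ∣ closedNbhd G v ∩ S ∣ ≥ 2
  distinct-members⇒∣closedNbhd∩S∣≥2 x≢y x∈N x∈S y∈N y∈S =
    distinct-members⇒∣p∣≥2 x≢y (x∈p∩q⁺ (∈closedNbhd⁺ x∈N , x∈S)) (x∈p∩q⁺ (∈closedNbhd⁺ y∈N , y∈S))

  two-neighbours-in-S : ∀ {S : Subset n} {v} → ∣ closedNbhd G v ∩ S ∣ ≥ 2 → v ∉ S →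
    ∃₂ λ x y → x ≢ y × Adj G v x × Adj G v y × x ∈ S × y ∈ S
  two-neighbours-in-S {S} {v} N∩S≥2 v∉S with ∣p∣≥2⇒distinct-members (closedNbhd G v ∩ S) N∩S≥2
  ... | x , y , x≢y , x∈N∩S , y∈N∩S
    with ∈closedNbhd∩∧≢⇒Adj x∈N∩S (≢v x∈N∩S) | ∈closedNbhd∩∧≢⇒Adj y∈N∩S (≢v y∈N∩S)
    where
    ≢v : ∀ {u} → u ∈ closedNbhd G v ∩ S → u ≢ v
    ≢v u∈N∩S refl = v∉S (proj₂ (x∈p∩q⁻ _ S u∈N∩S))
  ... | vx , x∈S | vy , y∈S = x , y , x≢y , vx , vy , x∈S , y∈S

  neighbour-in-S : ∀ {S : Subset n} {v} → ∣ closedNbhd G v ∩ S ∣ ≥ 2 → ∃[ u ] (Adj G v u × u ∈ S)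
  neighbour-in-S {S} {v} N∩S≥2 with ∣p∣≥2⇒distinct-members (closedNbhd G v ∩ S) N∩S≥2
  ... | x , y , x≢y , x∈N∩S , y∈N∩S with x ≟ v
  ...   | no x≢v    = x , ∈closedNbhd∩∧≢⇒Adj x∈N∩S x≢v
  ...   | yes refl = y , ∈closedNbhd∩∧≢⇒Adj y∈N∩S (x≢y ∘ sym)

  double-dominating⇒indicator-isTR2DF : ∀ {S : Subset n} → IsDoubleDominating G S → IsTR2DF G (indicator S)
  double-dominating⇒indicator-isTR2DF {S} dd = dominating , total
    where
    dominating : ∀ v → indicator S v ≡ l0 →
      (∃[ u ] (Adj G v u × indicator S u ≡ l2)) ⊎
      (∃₂ λ x y → x ≢ y × Adj G v x × Adj G v y × indicator S x ≡ l1 × indicator S y ≡ l1)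
    dominating v Sv≡l0 with two-neighbours-in-S (dd v) (indicator-∉ Sv≡l0)
    ... | x , y , x≢y , vx , vy , x∈S , y∈S = inj₂ (x , y , x≢y , vx , vy , indicator-∈ x∈S , indicator-∈ y∈S)

    total : ∀ v → indicator S v ≢ l0 → ∃[ u ] (Adj G v u × indicator S u ≢ l0)
    total v _ with neighbour-in-S (dd v)
    ... | u , vu , u∈S = u , vu , λ Su≡l0 → indicator-∉ Su≡l0 u∈S

  isTR2DF⇒V₁-double-dominating : ∀ {f : Fin n → Label} → IsTR2DF G f → (∀ v → f v ≢ l2) →
    IsDoubleDominating G (V₁ f)
  isTR2DF⇒V₁-double-dominating {f} (dominating , total) no-l2 v with f v in fv
  ... | l2 = contradiction fv (no-l2 v)
  ... | l0 with dominating v fv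
  ...   | inj₁ (u , _ , fu≡l2) = contradiction fu≡l2 (no-l2 u)
  ...   | inj₂ (x , y , x≢y , vx , vy , fx≡l1 , fy≡l1) =
          distinct-members⇒∣closedNbhd∩S∣≥2 x≢y (inj₂ vx) (∈V₁ fx≡l1) (inj₂ vy) (∈V₁ fy≡l1)
  isTR2DF⇒V₁-double-dominating {f} (_ , total) no-l2 v | l1
    with total v (λ fv≡l0 → contradiction (trans (sym fv) fv≡l0) λ ())
  ... | u , vu , fu≢l0 =
        distinct-members⇒∣closedNbhd∩S∣≥2 (Adj⇒≢ vu) (inj₂ vu) (∈V₁ (≢l0∧≢l2⇒≡l1 fu≢l0 (no-l2 u))) (inj₁ refl) (∈V₁ fv)

-- Connectivity and n ≥ 2 are unused: their role in the paper is to make some TR2DF exist,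
-- and here one is given.
mainTheorem7 : ∀ {n : ℕ} (G : Graph n) → n ≥ 2 → Connected G →
    (f : Fin n → Label) → IsGammaTR2Function G f → (∀ v → f v ≢ l2) →
    IsGammaX2 G (weight f)
mainTheorem7 G _ _ f (f-isTR2DF , f-minimum) no-l2 =
  (V₁ f , isTR2DF⇒V₁-double-dominating G f-isTR2DF no-l2 , sym (weight≡∣V₁∣ no-l2)) , minimum
  where
  open ≤-Reasoning
  minimum : ∀ S → IsDoubleDominating G S → weight f ≤ ∣ S ∣
  minimum S S-dd = begin
    weight f              ≤⟨ f-minimum (indicator S) (double-dominating⇒indicator-isTR2DF G S-dd) ⟩
    weight (indicator S)  ≡⟨ weight-indicator S ⟩
    ∣ S ∣                 ∎
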